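{- Let $\mathcal{M}$ be the set of Motzkin meanders that contain neither $UH$ nor $HD$ as a contiguous subword, and let $S(u)=\sum_{w\in\mathcal{M}} z^{|w|}u^{\mathrm{level}(w)}$. Put $$W=\sqrt{(1+z-2z^2-z^3)(1-3z+2z^2-z^3)},\qquad r_1=\frac{1-z-z^3-W}{2z(1-z)}.$$ Then $$S(u)=\frac{r_1}{z(1-z)(1-ur_1)},$$ and for every $j\ge0$ the generating function of the meanders in $\mathcal{M}$ ending at level $j$ is $[u^j]S(u)=\frac{r_1^{j+1}}{z(1-z)}$.
   Context: A Motzkin meander is a finite word $w$ over $\{U,H,D\}$ (heights $+1,0,-1$) all of whose prefixes have nonnegative height sum; $|w|$ is its length and $\mathrm{level}(w)$ its total height sum; the empty word is included; excursions are meanders of level $0$. "Contains $XY$ as a contiguous subword" means two consecutive letters are $X$ then $Y$. Generating functions are formal power series in $z$; $W$ is the formal power series square root with constant term $1$; $[u^j]$ is coefficient extraction. -}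

module Defs where

open import Data.Nat using (ℕ; zero; suc; _∸_; _≡ᵇ_)
open import Data.Bool using (Bool; true; false; _∧_; not; T?)
open import Data.List using (List; []; _∷_; _++_; map; concatMap; length; filter)
open import Data.Maybe using (Maybe; just; nothing)
open import Data.Integer using (+_)
open import Data.Rational using (ℚ; 0ℚ; 1ℚ; _+_; _*_; -_; _/_)
open import Relation.Binary.PropositionalEquality using (_≡_)

data Letter : Set where
  U H D : Letter

words : ℕ → List (List Letter)
words zero    = [] ∷ []
words (suc n) = concatMap (λ w → (U ∷ w) ∷ (H ∷ w) ∷ (D ∷ w) ∷ []) (words n)

runFrom : ℕ → List Letter → Maybe ℕ
runFrom h       []      = just h
runFrom h       (U ∷ w) = runFrom (suc h) w
runFrom h       (H ∷ w) = runFrom h w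
runFrom zero    (D ∷ w) = nothing
runFrom (suc h) (D ∷ w) = runFrom h w

meanderOfLevel : ℕ → List Letter → Bool
meanderOfLevel j w with runFrom 0 w
... | nothing = false
... | just l  = l ≡ᵇ j

containsUHorHD : List Letter → Bool
containsUHorHD (U ∷ H ∷ w) = true
containsUHorHD (H ∷ D ∷ w) = true
containsUHorHD (x ∷ w)     = containsUHorHD w
containsUHorHD []          = false

inM : ℕ → List Letter → Bool
inM j w = not (containsUHorHD w) ∧ meanderOfLevel j w

countM : ℕ → ℕ → ℕ
countM n j = length (filter (λ w → T? (inM j w)) (words n))

FPS : Set
FPS = ℕ → ℚ

fromℕℚ : ℕ → ℚ
fromℕℚ n = + n / 1

sumTo : ℕ → (ℕ → ℚ) → ℚ
sumTo zero    f = f 0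
sumTo (suc n) f = sumTo n f + f (suc n)

_⊕_ : FPS → FPS → FPS
(f ⊕ g) n = f n + g n

⊝_ : FPS → FPS
(⊝ f) n = - f n

_⊖_ : FPS → FPS → FPS
f ⊖ g = f ⊕ (⊝ g)

_⊛_ : FPS → FPS → FPS
(f ⊛ g) n = sumTo n (λ i → f i * g (n ∸ i))

infixl 6 _⊕_ _⊖_
infixl 7 _⊛_

const : ℚ → FPS
const c zero    = c
const c (suc n) = 0ℚ

one : FPS
one = const 1ℚ

zpow : ℕ → FPS
zpow zero    = one
zpow (suc k) zero    = 0ℚ
zpow (suc k) (suc n) = zpow k n

z : FPS
z = zpow 1

_^^_ : FPS → ℕ → FPS
f ^^ zero  = one
f ^^ suc k = f ⊛ (f ^^ k)

_≈_ : FPS → FPS → Set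
f ≈ g = ∀ n → f n ≡ g n

infix 4 _≈_

-- Bivariate series in u, z: B j is the coefficient of u^j (a series in z)

BFPS : Set
BFPS = ℕ → FPS

_⊛ᵤ_ : BFPS → BFPS → BFPS
(F ⊛ᵤ G) j n = sumTo j (λ i → (F i ⊛ G (j ∸ i)) n)

constᵤ : FPS → BFPS
constᵤ f zero    = f
constᵤ f (suc j) = λ _ → 0ℚ

uTimes : FPS → BFPS
uTimes f zero          = λ _ → 0ℚ
uTimes f (suc zero)    = f
uTimes f (suc (suc j)) = λ _ → 0ℚ

_⊕ᵤ_ : BFPS → BFPS → BFPS
(F ⊕ᵤ G) j = F j ⊕ G j

infixl 6 _⊕ᵤ_
infixl 7 _⊛ᵤ_

infix 4 _≈ᵤ_

_≈ᵤ_ : BFPS → BFPS → Set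
F ≈ᵤ G = ∀ j n → F j n ≡ G j n

S : BFPS
S j n = fromℕℚ (countM n j)

P : FPS
P = (one ⊕ z ⊖ const (fromℕℚ 2) ⊛ zpow 2 ⊖ zpow 3)
  ⊛ (one ⊖ const (fromℕℚ 3) ⊛ z ⊕ const (fromℕℚ 2) ⊛ zpow 2 ⊖ zpow 3)

zOneMinusZ : FPS
zOneMinusZ = z ⊛ (one ⊖ z)

{-# OPTIONS --safe #-}
module Submission where

-- Reading a word letter by letter, membership in 𝓜 is decided by its last letter and current
-- height, so the series X (q , j) of words ending in q at height j satisfy a linear system
-- X (q , j) = [q , j = H , 0] + z · Σ X (incoming states), which has a unique solution because z
-- shifts coefficients. The hypotheses on W make r₁ a root of the kernel
-- z(1−z)u² − (1−z−z³)u + z(1−z), as (1−z−z³)² − W² = 4z²(1−z)². For such an r₁, an explicit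
-- family built from powers of r₁ solves the system multiplied by z(1−z), and its sum over the
-- last letter is r₁^(j+1). The bivariate identity is the coefficientwise statement
-- z(1−z)(S_j − r₁ S_(j−1)) = 0 for j ≥ 1, together with z(1−z) S_0 = r₁.

open import Defs
open import Algebra.Bundles using (CommutativeRing; CommutativeMonoid)
import Algebra.Properties.CommutativeSemigroup as CommSemigroupProperties
import Algebra.Solver.Ring
open import Algebra.Solver.Ring.AlmostCommutativeRing using (fromCommutativeRing; _-Raw-AlmostCommutative⟶_)
open import Data.Bool using (Bool; true; false; _∧_; not; T?)
import Data.Bool.Properties as Boolₚ
import Data.Integer as ℤ
import Data.Integer.Properties as ℤₚ
open import Data.List using (List; []; _∷_; _∷ʳ_; _++_; map; foldl; foldr; concatMap; filter; length)
import Data.List.Properties as Listₚ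
open import Data.Maybe using (Maybe; just; nothing)
open import Data.Nat as ℕ using (ℕ; zero; suc; _∸_; _≤_; _≡ᵇ_; z≤n)
import Data.Nat.Properties as ℕₚ
open import Data.Nat.ListAction using (sum)
open import Data.Nat.ListAction.Properties using (sum-++)
open import Data.Product using (_×_; _,_)
import Data.Rational.Properties as ℚₚ
import Data.Rational.Unnormalised as ℚᵘ
import Data.Rational.Unnormalised.Properties as ℚᵘₚ
open import Function using (_∘_)
open import Relation.Binary.PropositionalEquality
import Relation.Binary.Reasoning.Setoid
open import Relation.Nullary using (yes; no)

-- Counting words by final state

module Counting where

  open import Data.Nat using (_+_)

  open CommSemigroupProperties ℕₚ.+-commutativeSemigroup using (interchange)

  indicator : Bool → ℕ
  indicator true  = 1
  indicator false = 0

  sum-map-+ : ∀ {A : Set} (f g : A → ℕ) xs →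
    sum (map (λ x → f x + g x) xs) ≡ sum (map f xs) + sum (map g xs)
  sum-map-+ f g []       = refl
  sum-map-+ f g (x ∷ xs) = trans (cong (f x + g x +_) (sum-map-+ f g xs))
    (interchange (f x) (g x) (sum (map f xs)) (sum (map g xs)))

  sum-map-zero : ∀ {A : Set} (xs : List A) → sum (map (λ _ → 0) xs) ≡ 0
  sum-map-zero []       = refl
  sum-map-zero (x ∷ xs) = sum-map-zero xs

  sum-map-sum-comm : ∀ {A B : Set} (f : A → B → ℕ) xs (ys : List B) →
    sum (map (λ x → sum (map (f x) ys)) xs) ≡ sum (map (λ y → sum (map (λ x → f x y) xs)) ys)
  sum-map-sum-comm f []       ys = sym (sum-map-zero ys)
  sum-map-sum-comm f (x ∷ xs) ys = trans (cong (sum (map (f x) ys) +_) (sum-map-sum-comm f xs ys))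
    (sym (sum-map-+ (f x) (λ y → sum (map (λ x → f x y) xs)) ys))

  sum-map-concatMap : ∀ {A B : Set} (f : B → ℕ) (g : A → List B) xs →
    sum (map f (concatMap g xs)) ≡ sum (map (λ x → sum (map f (g x))) xs)
  sum-map-concatMap f g []       = refl
  sum-map-concatMap f g (x ∷ xs) = begin
    sum (map f (g x ++ concatMap g xs))               ≡⟨ cong sum (Listₚ.map-++ f (g x) (concatMap g xs)) ⟩
    sum (map f (g x) ++ map f (concatMap g xs))       ≡⟨ sum-++ (map f (g x)) _ ⟩
    sum (map f (g x)) + sum (map f (concatMap g xs))  ≡⟨ cong (sum (map f (g x)) +_) (sum-map-concatMap f g xs) ⟩
    sum (map f (g x)) + sum (map (λ x → sum (map f (g x))) xs) ∎
    where open ≡-Reasoning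

  length-filter≡sum-indicator : ∀ {A : Set} (b : A → Bool) xs →
    length (filter (λ x → T? (b x)) xs) ≡ sum (map (λ x → indicator (b x)) xs)
  length-filter≡sum-indicator b []       = refl
  length-filter≡sum-indicator b (x ∷ xs) with b x
  ... | true  = cong suc (length-filter≡sum-indicator b xs)
  ... | false = length-filter≡sum-indicator b xs

  letters : List Letter
  letters = U ∷ H ∷ D ∷ []

  Σletters : (Letter → ℕ) → ℕ
  Σletters f = sum (map f letters)

  Σwords : ℕ → (List Letter → ℕ) → ℕ
  Σwords zero    f = f []
  Σwords (suc n) f = Σwords n (λ w → Σletters (λ x → f (x ∷ w)))

  Σwords-cong : ∀ n {f g : List Letter → ℕ} → (∀ w → f w ≡ g w) → Σwords n f ≡ Σwords n g
  Σwords-cong zero    f≗g = f≗g []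
  Σwords-cong (suc n) f≗g = Σwords-cong n (λ w → cong sum (Listₚ.map-cong (λ x → f≗g (x ∷ w)) letters))

  Σwords≡sum-words : ∀ n (f : List Letter → ℕ) → Σwords n f ≡ sum (map f (words n))
  Σwords≡sum-words zero    f = sym (ℕₚ.+-identityʳ (f []))
  Σwords≡sum-words (suc n) f =
    trans (Σwords≡sum-words n (λ w → Σletters (λ x → f (x ∷ w))))
          (sym (sum-map-concatMap f (λ w → (U ∷ w) ∷ (H ∷ w) ∷ (D ∷ w) ∷ []) (words n)))

  Σwords-∷ʳ : ∀ n (f : List Letter → ℕ) → Σwords (suc n) f ≡ Σletters (λ x → Σwords n (λ w → f (w ∷ʳ x)))
  Σwords-∷ʳ zero    f = refl
  Σwords-∷ʳ (suc n) f = Σwords-∷ʳ n (λ w → Σletters (λ y → f (y ∷ w)))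

  Σwords-sum-comm : ∀ {A : Set} n (f : A → List Letter → ℕ) xs →
    Σwords n (λ w → sum (map (λ x → f x w) xs)) ≡ sum (map (λ x → Σwords n (f x)) xs)
  Σwords-sum-comm zero    f xs = refl
  Σwords-sum-comm (suc n) f xs = trans
    (Σwords-cong n (λ w → sum-map-sum-comm (λ y x → f x (y ∷ w)) letters xs))
    (Σwords-sum-comm n (λ x w → Σletters (λ y → f x (y ∷ w))) xs)

  State : Set
  State = Letter × ℕ

  step : Maybe State → Letter → Maybe State
  step nothing            _ = nothing
  step (just (_ , h))     U = just (U , suc h)
  step (just (U , h))     H = nothing
  step (just (H , h))     H = just (H , h)
  step (just (D , h))     H = just (H , h)
  step (just (_ , zero))  D = nothing
  step (just (U , suc h)) D = just (D , h)
  step (just (H , suc h)) D = nothing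
  step (just (D , suc h)) D = just (D , h)

  -- A state is the last letter and the current height, nothing once the word has left 𝓜. The
  -- empty word starts as a word ending in H: it admits the same continuations, D being
  -- impossible at height 0.
  run : List Letter → Maybe State
  run = foldl step (just (H , 0))

  run-∷ʳ : ∀ w x → run (w ∷ʳ x) ≡ step (run w) x
  run-∷ʳ w x = Listₚ.foldl-∷ʳ step (just (H , 0)) x w

  foldl-step-nothing : ∀ w → foldl step nothing w ≡ nothing
  foldl-step-nothing []      = refl
  foldl-step-nothing (x ∷ w) = foldl-step-nothing w

  endsAt : ℕ → Maybe ℕ → Bool
  endsAt j nothing  = false
  endsAt j (just h) = h ≡ᵇ j

  accepts : ℕ → Maybe State → Bool
  accepts j nothing        = false
  accepts j (just (_ , h)) = h ≡ᵇ j

  accepts-foldl : ∀ j q h w →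
    accepts j (foldl step (just (q , h)) w) ≡ not (containsUHorHD (q ∷ w)) ∧ endsAt j (runFrom h w)
  accepts-foldl j U h       []      = refl
  accepts-foldl j H h       []      = refl
  accepts-foldl j D h       []      = refl
  accepts-foldl j U h       (U ∷ w) = accepts-foldl j U (suc h) w
  accepts-foldl j H h       (U ∷ w) = accepts-foldl j U (suc h) w
  accepts-foldl j D h       (U ∷ w) = accepts-foldl j U (suc h) w
  accepts-foldl j U h       (H ∷ w) = cong (accepts j) (foldl-step-nothing w)
  accepts-foldl j H h       (H ∷ w) = accepts-foldl j H h w
  accepts-foldl j D h       (H ∷ w) = accepts-foldl j H h w
  accepts-foldl j q zero    (D ∷ w) =
    trans (cong (accepts j) (foldl-step-nothing w)) (sym (Boolₚ.∧-zeroʳ (not (containsUHorHD (q ∷ D ∷ w)))))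
  accepts-foldl j U (suc h) (D ∷ w) = accepts-foldl j D h w
  accepts-foldl j H (suc h) (D ∷ w) = cong (accepts j) (foldl-step-nothing w)
  accepts-foldl j D (suc h) (D ∷ w) = accepts-foldl j D h w

  meanderOfLevel≡endsAt : ∀ j w → meanderOfLevel j w ≡ endsAt j (runFrom 0 w)
  meanderOfLevel≡endsAt j w with runFrom 0 w
  ... | nothing = refl
  ... | just l  = refl

  inM≡accepts-run : ∀ j w → inM j w ≡ accepts j (run w)
  inM≡accepts-run j w = trans (cong (not (containsUHorHD w) ∧_) (meanderOfLevel≡endsAt j w))
    (trans (prepend-H j w) (sym (accepts-foldl j H 0 w)))
    where
    prepend-H : ∀ j w → not (containsUHorHD w) ∧ endsAt j (runFrom 0 w)
                    ≡ not (containsUHorHD (H ∷ w)) ∧ endsAt j (runFrom 0 w)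
    prepend-H j []      = refl
    prepend-H j (U ∷ w) = refl
    prepend-H j (H ∷ w) = refl
    prepend-H j (D ∷ w) = Boolₚ.∧-zeroʳ (not (containsUHorHD (D ∷ w)))

  sameLetter : Letter → Letter → Bool
  sameLetter U U = true
  sameLetter H H = true
  sameLetter D D = true
  sameLetter _ _ = false

  δ : State → Maybe State → ℕ
  δ t       nothing         = 0
  δ (q , j) (just (q′ , h)) = indicator (sameLetter q′ q ∧ (h ≡ᵇ j))

  incoming : State → List State
  incoming (U , zero)  = []
  incoming (U , suc j) = (U , j) ∷ (H , j) ∷ (D , j) ∷ []
  incoming (H , j)     = (H , j) ∷ (D , j) ∷ []
  incoming (D , j)     = (U , suc j) ∷ (D , suc j) ∷ []

  δ-step≡δ-incoming : ∀ t s → Σletters (λ x → δ t (step s x)) ≡ sum (map (λ t′ → δ t′ s) (incoming t))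
  δ-step≡δ-incoming t           nothing             = sym (sum-map-zero (incoming t))
  δ-step≡δ-incoming (U , zero)  (just (U , zero))   = refl
  δ-step≡δ-incoming (U , zero)  (just (U , suc h))  = refl
  δ-step≡δ-incoming (U , zero)  (just (H , zero))   = refl
  δ-step≡δ-incoming (U , zero)  (just (H , suc h))  = refl
  δ-step≡δ-incoming (U , zero)  (just (D , zero))   = refl
  δ-step≡δ-incoming (U , zero)  (just (D , suc h))  = refl
  δ-step≡δ-incoming (U , suc j) (just (U , zero))   = refl
  δ-step≡δ-incoming (U , suc j) (just (U , suc h))  = refl
  δ-step≡δ-incoming (U , suc j) (just (H , zero))   = refl
  δ-step≡δ-incoming (U , suc j) (just (H , suc h))  = refl
  δ-step≡δ-incoming (U , suc j) (just (D , zero))   = refl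
  δ-step≡δ-incoming (U , suc j) (just (D , suc h))  = refl
  δ-step≡δ-incoming (H , j)     (just (U , zero))   = refl
  δ-step≡δ-incoming (H , j)     (just (U , suc h))  = refl
  δ-step≡δ-incoming (H , j)     (just (H , zero))   = refl
  δ-step≡δ-incoming (H , j)     (just (H , suc h))  = refl
  δ-step≡δ-incoming (H , j)     (just (D , zero))   = refl
  δ-step≡δ-incoming (H , j)     (just (D , suc h))  = refl
  δ-step≡δ-incoming (D , j)     (just (U , zero))   = refl
  δ-step≡δ-incoming (D , j)     (just (U , suc h))  = refl
  δ-step≡δ-incoming (D , j)     (just (H , zero))   = refl
  δ-step≡δ-incoming (D , j)     (just (H , suc h))  = refl
  δ-step≡δ-incoming (D , j)     (just (D , zero))   = refl
  δ-step≡δ-incoming (D , j)     (just (D , suc h))  = refl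

  count : State → ℕ → ℕ
  count t n = Σwords n (λ w → δ t (run w))

  count-suc : ∀ t n → count t (suc n) ≡ sum (map (λ t′ → count t′ n) (incoming t))
  count-suc t n = begin
    Σwords (suc n) (λ w → δ t (run w))
      ≡⟨ Σwords-∷ʳ n (λ w → δ t (run w)) ⟩
    Σletters (λ x → Σwords n (λ w → δ t (run (w ∷ʳ x))))
      ≡⟨ cong sum (Listₚ.map-cong (λ x → Σwords-cong n (λ w → cong (δ t) (run-∷ʳ w x))) letters) ⟩
    Σletters (λ x → Σwords n (λ w → δ t (step (run w) x)))
      ≡⟨ Σwords-sum-comm n (λ x w → δ t (step (run w) x)) letters ⟨
    Σwords n (λ w → Σletters (λ x → δ t (step (run w) x)))
      ≡⟨ Σwords-cong n (λ w → δ-step≡δ-incoming t (run w)) ⟩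
    Σwords n (λ w → sum (map (λ t′ → δ t′ (run w)) (incoming t)))
      ≡⟨ Σwords-sum-comm n (λ t′ w → δ t′ (run w)) (incoming t) ⟩
    sum (map (λ t′ → count t′ n) (incoming t)) ∎
    where open ≡-Reasoning

  indicator-accepts≡Σδ : ∀ j s → indicator (accepts j s) ≡ Σletters (λ q → δ (q , j) s)
  indicator-accepts≡Σδ j nothing        = refl
  indicator-accepts≡Σδ j (just (U , h)) = sym (ℕₚ.+-identityʳ _)
  indicator-accepts≡Σδ j (just (H , h)) = sym (ℕₚ.+-identityʳ _)
  indicator-accepts≡Σδ j (just (D , h)) = sym (ℕₚ.+-identityʳ _)

  countM≡Σcount : ∀ n j → countM n j ≡ Σletters (λ q → count (q , j) n)
  countM≡Σcount n j = begin
    length (filter (λ w → T? (inM j w)) (words n))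
      ≡⟨ length-filter≡sum-indicator (inM j) (words n) ⟩
    sum (map (λ w → indicator (inM j w)) (words n))
      ≡⟨ Σwords≡sum-words n (λ w → indicator (inM j w)) ⟨
    Σwords n (λ w → indicator (inM j w))
      ≡⟨ Σwords-cong n (λ w → trans (cong indicator (inM≡accepts-run j w)) (indicator-accepts≡Σδ j (run w))) ⟩
    Σwords n (λ w → Σletters (λ q → δ (q , j) (run w)))
      ≡⟨ Σwords-sum-comm n (λ q w → δ (q , j) (run w)) letters ⟩
    Σletters (λ q → count (q , j) n) ∎
    where open ≡-Reasoning

open Counting

-- Formal power series

open import Data.Rational as ℚ using (ℚ; 0ℚ; 1ℚ; _+_; _*_; -_; toℚᵘ)

open CommSemigroupProperties (CommutativeMonoid.commutativeSemigroup ℚₚ.+-0-commutativeMonoid)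
  using (interchange)

sumTo-cong : ∀ n {f g : ℕ → ℚ} → (∀ i → i ≤ n → f i ≡ g i) → sumTo n f ≡ sumTo n g
sumTo-cong zero    f≗g = f≗g 0 z≤n
sumTo-cong (suc n) f≗g =
  cong₂ _+_ (sumTo-cong n (λ i i≤n → f≗g i (ℕₚ.m≤n⇒m≤1+n i≤n))) (f≗g (suc n) ℕₚ.≤-refl)

sumTo-+ : ∀ n (f g : ℕ → ℚ) → sumTo n (λ i → f i + g i) ≡ sumTo n f + sumTo n g
sumTo-+ zero    f g = refl
sumTo-+ (suc n) f g = trans (cong (_+ (f (suc n) + g (suc n))) (sumTo-+ n f g))
  (interchange (sumTo n f) (sumTo n g) (f (suc n)) (g (suc n)))

sumTo-*ˡ : ∀ n c (f : ℕ → ℚ) → sumTo n (λ i → c * f i) ≡ c * sumTo n f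
sumTo-*ˡ zero    c f = refl
sumTo-*ˡ (suc n) c f = trans (cong (_+ c * f (suc n)) (sumTo-*ˡ n c f))
  (sym (ℚₚ.*-distribˡ-+ c (sumTo n f) (f (suc n))))

sumTo-zero : ∀ n {f : ℕ → ℚ} → (∀ i → i ≤ n → f i ≡ 0ℚ) → sumTo n f ≡ 0ℚ
sumTo-zero zero    f≡0 = f≡0 0 z≤n
sumTo-zero (suc n) f≡0 =
  trans (cong₂ _+_ (sumTo-zero n (λ i i≤n → f≡0 i (ℕₚ.m≤n⇒m≤1+n i≤n))) (f≡0 (suc n) ℕₚ.≤-refl))
        (ℚₚ.+-identityˡ 0ℚ)

sumTo-suc : ∀ n (f : ℕ → ℚ) → sumTo (suc n) f ≡ f 0 + sumTo n (f ∘ suc)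
sumTo-suc zero    f = refl
sumTo-suc (suc n) f = trans (cong (_+ f (suc (suc n))) (sumTo-suc n f))
  (ℚₚ.+-assoc (f 0) (sumTo n (f ∘ suc)) (f (suc (suc n))))

sumTo-reverse : ∀ n (f : ℕ → ℚ) → sumTo n f ≡ sumTo n (λ i → f (n ∸ i))
sumTo-reverse zero    f = refl
sumTo-reverse (suc n) f = begin
  sumTo n f + f (suc n)                   ≡⟨ ℚₚ.+-comm (sumTo n f) (f (suc n)) ⟩
  f (suc n) + sumTo n f                   ≡⟨ cong (f (suc n) +_) (sumTo-reverse n f) ⟩
  f (suc n) + sumTo n (λ i → f (n ∸ i))   ≡⟨ sym (sumTo-suc n (λ i → f (suc n ∸ i))) ⟩
  sumTo (suc n) (λ i → f (suc n ∸ i))     ∎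
  where open ≡-Reasoning

0ₛ : FPS
0ₛ = const 0ℚ

0ₛ-coeff : ∀ n → 0ₛ n ≡ 0ℚ
0ₛ-coeff zero    = refl
0ₛ-coeff (suc n) = refl

infixr 8 _•_

_•_ : ℚ → FPS → FPS
(c • f) n = c * f n

⊛-tail : ∀ (f g : FPS) → (f ⊛ g) ∘ suc ≈ f 0 • (g ∘ suc) ⊕ (f ∘ suc) ⊛ g
⊛-tail f g n = sumTo-suc n (λ i → f i * g (suc n ∸ i))

⊛-cong : ∀ {f f′ g g′} → f ≈ f′ → g ≈ g′ → f ⊛ g ≈ f′ ⊛ g′
⊛-cong f≈f′ g≈g′ n = sumTo-cong n (λ i _ → cong₂ _*_ (f≈f′ i) (g≈g′ (n ∸ i)))

⊛-comm : ∀ (f g : FPS) → f ⊛ g ≈ g ⊛ f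
⊛-comm f g n = trans (sumTo-reverse n (λ i → f i * g (n ∸ i))) (sumTo-cong n λ i i≤n →
  trans (cong (λ k → f (n ∸ i) * g k) (ℕₚ.m∸[m∸n]≡n i≤n)) (ℚₚ.*-comm (f (n ∸ i)) (g i)))

⊛-distribʳ : ∀ (f g h : FPS) → (g ⊕ h) ⊛ f ≈ g ⊛ f ⊕ h ⊛ f
⊛-distribʳ f g h n = trans (sumTo-cong n (λ i _ → ℚₚ.*-distribʳ-+ (f (n ∸ i)) (g i) (h i)))
  (sumTo-+ n (λ i → g i * f (n ∸ i)) (λ i → h i * f (n ∸ i)))

⊛-distribˡ : ∀ (f g h : FPS) → f ⊛ (g ⊕ h) ≈ f ⊛ g ⊕ f ⊛ h
⊛-distribˡ f g h n = trans (⊛-comm f (g ⊕ h) n)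
  (trans (⊛-distribʳ f g h n) (cong₂ _+_ (⊛-comm g f n) (⊛-comm h f n)))

•-⊛ : ∀ c (f g : FPS) → (c • f) ⊛ g ≈ c • (f ⊛ g)
•-⊛ c f g n = trans (sumTo-cong n (λ i _ → ℚₚ.*-assoc c (f i) (g (n ∸ i))))
  (sumTo-*ˡ n c (λ i → f i * g (n ∸ i)))

⊛-vanishˡ : ∀ {f} (g : FPS) → (∀ n → f n ≡ 0ℚ) → ∀ n → (f ⊛ g) n ≡ 0ℚ
⊛-vanishˡ {f} g f≡0 n = sumTo-zero n (λ i _ →
  trans (cong (_* g (n ∸ i)) (f≡0 i)) (ℚₚ.*-zeroˡ (g (n ∸ i))))

⊛-identityˡ : ∀ (f : FPS) → one ⊛ f ≈ f
⊛-identityˡ f zero    = ℚₚ.*-identityˡ (f 0)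
⊛-identityˡ f (suc n) = begin
  (one ⊛ f) (suc n)                        ≡⟨ ⊛-tail one f n ⟩
  1ℚ * f (suc n) + ((one ∘ suc) ⊛ f) n     ≡⟨ cong₂ _+_ (ℚₚ.*-identityˡ (f (suc n)))
                                                           (⊛-vanishˡ f (λ _ → refl) n) ⟩
  f (suc n) + 0ℚ                           ≡⟨ ℚₚ.+-identityʳ (f (suc n)) ⟩
  f (suc n)                                ∎
  where open ≡-Reasoning

⊛-assoc : ∀ (f g h : FPS) → (f ⊛ g) ⊛ h ≈ f ⊛ (g ⊛ h)
⊛-assoc f g h zero    = ℚₚ.*-assoc (f 0) (g 0) (h 0)
⊛-assoc f g h (suc n) = begin
  ((f ⊛ g) ⊛ h) (suc n)
    ≡⟨ ⊛-tail (f ⊛ g) h n ⟩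
  f 0 * g 0 * h (suc n) + (((f ⊛ g) ∘ suc) ⊛ h) n
    ≡⟨ cong (f 0 * g 0 * h (suc n) +_) (⊛-cong {g = h} (⊛-tail f g) (λ _ → refl) n) ⟩
  f 0 * g 0 * h (suc n) + ((f 0 • (g ∘ suc) ⊕ (f ∘ suc) ⊛ g) ⊛ h) n
    ≡⟨ cong (f 0 * g 0 * h (suc n) +_)
         (trans (⊛-distribʳ h (f 0 • (g ∘ suc)) ((f ∘ suc) ⊛ g) n)
                (cong₂ _+_ (•-⊛ (f 0) (g ∘ suc) h n) (⊛-assoc (f ∘ suc) g h n))) ⟩
  f 0 * g 0 * h (suc n) + (f 0 * ((g ∘ suc) ⊛ h) n + ((f ∘ suc) ⊛ (g ⊛ h)) n)
    ≡⟨ sym (ℚₚ.+-assoc (f 0 * g 0 * h (suc n)) _ _) ⟩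
  f 0 * g 0 * h (suc n) + f 0 * ((g ∘ suc) ⊛ h) n + ((f ∘ suc) ⊛ (g ⊛ h)) n
    ≡⟨ cong (_+ ((f ∘ suc) ⊛ (g ⊛ h)) n)
         (trans (cong (_+ f 0 * ((g ∘ suc) ⊛ h) n) (ℚₚ.*-assoc (f 0) (g 0) (h (suc n))))
                (sym (ℚₚ.*-distribˡ-+ (f 0) (g 0 * h (suc n)) (((g ∘ suc) ⊛ h) n)))) ⟩
  f 0 * (g 0 * h (suc n) + ((g ∘ suc) ⊛ h) n) + ((f ∘ suc) ⊛ (g ⊛ h)) n
    ≡⟨ sym (cong (λ x → f 0 * x + ((f ∘ suc) ⊛ (g ⊛ h)) n) (⊛-tail g h n)) ⟩
  f 0 * (g ⊛ h) (suc n) + ((f ∘ suc) ⊛ (g ⊛ h)) n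
    ≡⟨ sym (⊛-tail f (g ⊛ h) n) ⟩
  (f ⊛ (g ⊛ h)) (suc n) ∎
  where open ≡-Reasoning

⊛-identityʳ : ∀ (f : FPS) → f ⊛ one ≈ f
⊛-identityʳ f n = trans (⊛-comm f one n) (⊛-identityˡ f n)

-- A record rather than _≈_ itself, which unfolds to a Π-type and so blocks unification.
infix 4 _≋_

record _≋_ (f g : FPS) : Set where
  constructor coeffwise
  field coeff : f ≈ g

open _≋_ public

FPS-commutativeRing : CommutativeRing _ _
FPS-commutativeRing = record
  { Carrier = FPS ; _≈_ = _≋_ ; _+_ = _⊕_ ; _*_ = _⊛_ ; -_ = ⊝_ ; 0# = 0ₛ ; 1# = one
  ; isCommutativeRing = record
    { isRing = record
      { +-isAbelianGroup = record
        { isGroup = record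
          { isMonoid = record
            { isSemigroup = record
              { isMagma = record
                { isEquivalence = record
                  { refl  = coeffwise (λ _ → refl)
                  ; sym   = λ p → coeffwise (λ n → sym (coeff p n))
                  ; trans = λ p q → coeffwise (λ n → trans (coeff p n) (coeff q n)) }
                ; ∙-cong = λ p q → coeffwise (λ n → cong₂ _+_ (coeff p n) (coeff q n)) }
              ; assoc = λ f g h → coeffwise (λ n → ℚₚ.+-assoc (f n) (g n) (h n)) }
            ; identity = (λ f → coeffwise (λ n → trans (cong (_+ f n) (0ₛ-coeff n)) (ℚₚ.+-identityˡ (f n))))
                       , (λ f → coeffwise (λ n → trans (cong (f n +_) (0ₛ-coeff n)) (ℚₚ.+-identityʳ (f n)))) }
          ; inverse = (λ f → coeffwise (λ n → trans (ℚₚ.+-inverseˡ (f n)) (sym (0ₛ-coeff n))))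
                    , (λ f → coeffwise (λ n → trans (ℚₚ.+-inverseʳ (f n)) (sym (0ₛ-coeff n))))
          ; ⁻¹-cong = λ p → coeffwise (λ n → cong -_ (coeff p n)) }
        ; comm = λ f g → coeffwise (λ n → ℚₚ.+-comm (f n) (g n)) }
      ; *-cong = λ p q → coeffwise (⊛-cong (coeff p) (coeff q))
      ; *-assoc = λ f g h → coeffwise (⊛-assoc f g h)
      ; *-identity = (λ f → coeffwise (⊛-identityˡ f)) , (λ f → coeffwise (⊛-identityʳ f))
      ; distrib = (λ f g h → coeffwise (⊛-distribˡ f g h)) , (λ f g h → coeffwise (⊛-distribʳ f g h)) }
    ; *-comm = λ f g → coeffwise (⊛-comm f g) }
  }

const-homomorphism : CommutativeRing.rawRing ℚₚ.+-*-commutativeRing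
                       -Raw-AlmostCommutative⟶ fromCommutativeRing FPS-commutativeRing
const-homomorphism = record
  { ⟦_⟧    = const
  ; +-homo = λ a b → coeffwise λ { zero → refl ; (suc n) → sym (ℚₚ.+-identityˡ 0ℚ) }
  ; *-homo = λ a b → coeffwise λ { zero → refl ; (suc n) → sym (begin
      (const a ⊛ const b) (suc n)             ≡⟨ ⊛-tail (const a) (const b) n ⟩
      a * 0ℚ + ((const a ∘ suc) ⊛ const b) n  ≡⟨ cong₂ _+_ (ℚₚ.*-zeroʳ a) (⊛-vanishˡ (const b) (λ _ → refl) n) ⟩
      0ℚ + 0ℚ                                 ≡⟨ ℚₚ.+-identityˡ 0ℚ ⟩
      0ℚ                                      ∎) }
  ; -‿homo = λ a → coeffwise λ { zero → refl ; (suc n) → refl }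
  ; 0-homo = coeffwise (λ _ → refl)
  ; 1-homo = coeffwise (λ _ → refl)
  }
  where open ≡-Reasoning

const-≟ : ∀ a b → Maybe (const a ≋ const b)
const-≟ a b with a ℚ.≟ b
... | yes refl = just (coeffwise (λ _ → refl))
... | no  _    = nothing

module FPS-Solver = Algebra.Solver.Ring
  (CommutativeRing.rawRing ℚₚ.+-*-commutativeRing) (fromCommutativeRing FPS-commutativeRing)
  const-homomorphism const-≟

module SetoidReasoning = Relation.Binary.Reasoning.Setoid (CommutativeRing.setoid FPS-commutativeRing)
open CommutativeRing FPS-commutativeRing using (+-cong; *-cong; -‿cong; distribˡ)
  renaming (refl to ≋-refl; sym to ≋-sym; trans to ≋-trans)
open FPS-Solver using (Polynomial; solve; _:+_; _:*_; _:-_; :-_; con; _:=_)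

≋-refl-at : ∀ f → f ≋ f
≋-refl-at f = ≋-refl

z⊛-zero : ∀ (f : FPS) → (z ⊛ f) 0 ≡ 0ℚ
z⊛-zero f = ℚₚ.*-zeroˡ (f 0)

z⊛-tail : ∀ (f : FPS) n → (z ⊛ f) (suc n) ≡ f n
z⊛-tail f n = begin
  (z ⊛ f) (suc n)                ≡⟨ ⊛-tail z f n ⟩
  0ℚ * f (suc n) + (one ⊛ f) n   ≡⟨ cong₂ _+_ (ℚₚ.*-zeroˡ (f (suc n))) (⊛-identityˡ f n) ⟩
  0ℚ + f n                       ≡⟨ ℚₚ.+-identityˡ (f n) ⟩
  f n                            ∎
  where open ≡-Reasoning

zpow-suc : ∀ k → zpow (suc k) ≋ z ⊛ zpow k
zpow-suc k = coeffwise λ where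
  zero    → sym (z⊛-zero (zpow k))
  (suc n) → sym (z⊛-tail (zpow k) n)

z⊛-cancel : ∀ {f} → z ⊛ f ≋ 0ₛ → f ≋ 0ₛ
z⊛-cancel {f} zf≋0 = coeffwise λ n →
  trans (sym (z⊛-tail f n)) (trans (coeff zf≋0 (suc n)) (sym (0ₛ-coeff n)))

one⊖z⊛-cancel : ∀ {f} → (one ⊖ z) ⊛ f ≋ 0ₛ → f ≋ 0ₛ
one⊖z⊛-cancel {f} [1-z]f≋0 = coeffwise f≈0
  where
  open SetoidReasoning
  f≋zf : f ≋ z ⊛ f
  f≋zf = begin
    f                         ≈⟨ solve 2 (λ x y → y := (con 1ℚ :- x) :* y :+ x :* y) ≋-refl z f ⟩
    (one ⊖ z) ⊛ f ⊕ z ⊛ f     ≈⟨ +-cong [1-z]f≋0 ≋-refl ⟩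
    0ₛ ⊕ z ⊛ f                ≈⟨ solve 1 (λ y → con 0ℚ :+ y := y) ≋-refl (z ⊛ f) ⟩
    z ⊛ f                     ∎
  f≈0 : ∀ n → f n ≡ 0ₛ n
  f≈0 zero    = trans (coeff f≋zf 0) (z⊛-zero f)
  f≈0 (suc n) = trans (coeff f≋zf (suc n)) (trans (z⊛-tail f n) (trans (f≈0 n) (0ₛ-coeff n)))

zOneMinusZ⊛-cancel : ∀ {f} → zOneMinusZ ⊛ f ≋ 0ₛ → f ≋ 0ₛ
zOneMinusZ⊛-cancel {f} zz⊛f≋0 =
  one⊖z⊛-cancel (z⊛-cancel (≋-trans (≋-sym (coeffwise (⊛-assoc z (one ⊖ z) f))) zz⊛f≋0))

Σₛ : List FPS → FPS
Σₛ = foldr _⊕_ 0ₛ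

Σₛ-map-cong : ∀ {A : Set} {X Y : A → FPS} → (∀ a → X a ≋ Y a) → ∀ xs → Σₛ (map X xs) ≋ Σₛ (map Y xs)
Σₛ-map-cong X≋Y []       = ≋-refl
Σₛ-map-cong X≋Y (a ∷ xs) = +-cong (X≋Y a) (Σₛ-map-cong X≋Y xs)

Σₛ-map-coeff-cong : ∀ {A : Set} {X Y : A → FPS} n → (∀ a → X a n ≡ Y a n) →
  ∀ xs → Σₛ (map X xs) n ≡ Σₛ (map Y xs) n
Σₛ-map-coeff-cong n X≡Y []       = refl
Σₛ-map-coeff-cong n X≡Y (a ∷ xs) = cong₂ _+_ (X≡Y a) (Σₛ-map-coeff-cong n X≡Y xs)

⊛-Σₛ : ∀ {A : Set} c (X : A → FPS) xs → c ⊛ Σₛ (map X xs) ≋ Σₛ (map (λ a → c ⊛ X a) xs)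
⊛-Σₛ c X []       = solve 1 (λ c → c :* con 0ℚ := con 0ℚ) ≋-refl c
⊛-Σₛ c X (a ∷ xs) = ≋-trans (distribˡ c (X a) (Σₛ (map X xs))) (+-cong (≋-refl-at (c ⊛ X a)) (⊛-Σₛ c X xs))

fromℕℚ-+ : ∀ m n → fromℕℚ (m ℕ.+ n) ≡ fromℕℚ m + fromℕℚ n
fromℕℚ-+ m n = ℚₚ.toℚᵘ-injective (begin
  toℚᵘ (fromℕℚ (m ℕ.+ n))
    ≈⟨ ℚₚ.toℚᵘ-fromℚᵘ (fromℕᵘ (m ℕ.+ n)) ⟩
  fromℕᵘ (m ℕ.+ n)
    ≈⟨ ℚᵘ.*≡* (cong (ℤ._* ℤ.+ 1) (trans (ℤₚ.pos-+ m n)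
         (sym (cong₂ ℤ._+_ (ℤₚ.*-identityʳ (ℤ.+ m)) (ℤₚ.*-identityʳ (ℤ.+ n)))))) ⟩
  fromℕᵘ m ℚᵘ.+ fromℕᵘ n
    ≈⟨ ℚᵘₚ.+-cong (ℚᵘₚ.≃-sym (ℚₚ.toℚᵘ-fromℚᵘ (fromℕᵘ m))) (ℚᵘₚ.≃-sym (ℚₚ.toℚᵘ-fromℚᵘ (fromℕᵘ n))) ⟩
  toℚᵘ (fromℕℚ m) ℚᵘ.+ toℚᵘ (fromℕℚ n)
    ≈⟨ ℚᵘₚ.≃-sym (ℚₚ.toℚᵘ-homo-+ (fromℕℚ m) (fromℕℚ n)) ⟩
  toℚᵘ (fromℕℚ m + fromℕℚ n) ∎)
  where
  open ℚᵘₚ.≃-Reasoning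
  fromℕᵘ : ℕ → ℚᵘ.ℚᵘ
  fromℕᵘ k = ℚᵘ.mkℚᵘ (ℤ.+ k) 0

fromℕℚ-sum : ∀ {A : Set} (f : A → ℕ) (X : A → FPS) n → (∀ a → X a n ≡ fromℕℚ (f a)) →
  ∀ xs → fromℕℚ (sum (map f xs)) ≡ Σₛ (map X xs) n
fromℕℚ-sum f X n X≡f []       = sym (0ₛ-coeff n)
fromℕℚ-sum f X n X≡f (a ∷ xs) =
  trans (fromℕℚ-+ (f a) (sum (map f xs))) (cong₂ _+_ (sym (X≡f a)) (fromℕℚ-sum f X n X≡f xs))

-- The transfer system

initial : State → FPS
initial (H , zero) = one
initial _          = 0ₛ

initial-suc : ∀ t n → initial t (suc n) ≡ 0ℚ
initial-suc (U , j)     n = refl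
initial-suc (H , zero)  n = refl
initial-suc (H , suc j) n = refl
initial-suc (D , j)     n = refl

IsSolution : FPS → (State → FPS) → Set
IsSolution c X = ∀ t → X t ≋ c ⊛ initial t ⊕ z ⊛ Σₛ (map X (incoming t))

solution-unique : ∀ {c X Y} → IsSolution c X → IsSolution c Y → ∀ t → X t ≋ Y t
solution-unique {c} {X} {Y} X-sol Y-sol t = coeffwise (λ n → agree n t)
  where
  ΣX ΣY : State → FPS
  ΣX t = Σₛ (map X (incoming t))
  ΣY t = Σₛ (map Y (incoming t))
  agree : ∀ n t → X t n ≡ Y t n
  agree zero    t = trans (coeff (X-sol t) 0) (trans
    (cong ((c ⊛ initial t) 0 +_) (trans (z⊛-zero (ΣX t)) (sym (z⊛-zero (ΣY t)))))
    (sym (coeff (Y-sol t) 0)))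
  agree (suc n) t = trans (coeff (X-sol t) (suc n)) (trans
    (cong ((c ⊛ initial t) (suc n) +_) (trans (z⊛-tail (ΣX t) n)
      (trans (Σₛ-map-coeff-cong {X = X} {Y = Y} n (λ t′ → agree n t′) (incoming t)) (sym (z⊛-tail (ΣY t) n)))))
    (sym (coeff (Y-sol t) (suc n))))

countSeries : State → FPS
countSeries t n = fromℕℚ (count t n)

countSeries-zero : ∀ t → countSeries t 0 ≡ initial t 0
countSeries-zero (U , j)     = refl
countSeries-zero (H , zero)  = refl
countSeries-zero (H , suc j) = refl
countSeries-zero (D , j)     = refl

countSeries-solution : IsSolution one countSeries
countSeries-solution t = coeffwise λ where
    zero    → sym (begin
      (one ⊛ initial t) 0 + (z ⊛ Σ) 0   ≡⟨ cong₂ _+_ (⊛-identityˡ (initial t) 0) (z⊛-zero Σ) ⟩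
      initial t 0 + 0ℚ                  ≡⟨ ℚₚ.+-identityʳ (initial t 0) ⟩
      initial t 0                       ≡⟨ countSeries-zero t ⟨
      countSeries t 0                   ∎)
    (suc n) → sym (begin
      (one ⊛ initial t) (suc n) + (z ⊛ Σ) (suc n)
        ≡⟨ cong₂ _+_ (trans (⊛-identityˡ (initial t) (suc n)) (initial-suc t n)) (z⊛-tail Σ n) ⟩
      0ℚ + Σ n
        ≡⟨ ℚₚ.+-identityˡ (Σ n) ⟩
      Σ n
        ≡⟨ fromℕℚ-sum (λ t′ → count t′ n) countSeries n (λ _ → refl) (incoming t) ⟨
      fromℕℚ (sum (map (λ t′ → count t′ n) (incoming t)))
        ≡⟨ cong fromℕℚ (count-suc t n) ⟨
      countSeries t (suc n) ∎)
  where
  open ≡-Reasoning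
  Σ = Σₛ (map countSeries (incoming t))

solution-scale : ∀ c {X} → IsSolution one X → IsSolution c (λ t → c ⊛ X t)
solution-scale c {X} X-sol t = begin
  c ⊛ X t
    ≈⟨ *-cong (≋-refl-at c) (X-sol t) ⟩
  c ⊛ (one ⊛ initial t ⊕ z ⊛ Σ)
    ≈⟨ solve 4 (λ c s x y → c :* (con 1ℚ :* s :+ x :* y) := c :* s :+ x :* (c :* y)) ≋-refl c (initial t) z Σ ⟩
  c ⊛ initial t ⊕ z ⊛ (c ⊛ Σ)
    ≈⟨ +-cong (≋-refl-at (c ⊛ initial t)) (*-cong (≋-refl-at z) (⊛-Σₛ c X (incoming t))) ⟩
  c ⊛ initial t ⊕ z ⊛ Σₛ (map (λ t′ → c ⊛ X t′) (incoming t)) ∎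
  where
  open SetoidReasoning
  Σ = Σₛ (map X (incoming t))

S≋Σ-countSeries : ∀ j → S j ≋ Σₛ (map (λ q → countSeries (q , j)) letters)
S≋Σ-countSeries j = coeffwise λ n → trans (cong fromℕℚ (countM≡Σcount n j))
  (fromℕℚ-sum (λ q → count (q , j) n) (λ q → countSeries (q , j)) n (λ _ → refl) letters)

kernel : FPS → FPS
kernel r = zOneMinusZ ⊛ (r ⊛ r) ⊖ (one ⊖ z ⊖ z ⊛ (z ⊛ z)) ⊛ r ⊕ zOneMinusZ

IsKernelRoot : FPS → Set
IsKernelRoot r = kernel r ≋ 0ₛ

zOneMinusZᵖ : ∀ {n} → Polynomial n → Polynomial n
zOneMinusZᵖ x = x :* (con 1ℚ :- x)

kernelᵖ : ∀ {n} → Polynomial n → Polynomial n → Polynomial n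
kernelᵖ x ρ = zOneMinusZᵖ x :* (ρ :* ρ) :- (con 1ℚ :- x :- x :* (x :* x)) :* ρ :+ zOneMinusZᵖ x

P[_,_] : FPS → FPS → FPS
P[ t₂ , t₃ ] = (one ⊕ z ⊖ const (fromℕℚ 2) ⊛ t₂ ⊖ t₃)
             ⊛ (one ⊖ const (fromℕℚ 3) ⊛ z ⊕ const (fromℕℚ 2) ⊛ t₂ ⊖ t₃)

P[]-cong : ∀ {t₂ t₂′ t₃ t₃′} → t₂ ≋ t₂′ → t₃ ≋ t₃′ → P[ t₂ , t₃ ] ≋ P[ t₂′ , t₃′ ]
P[]-cong t₂≋ t₃≋ =
  *-cong (+-cong (+-cong (≋-refl-at (one ⊕ z)) (-‿cong 2t₂≋)) (-‿cong t₃≋))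
         (+-cong (+-cong (≋-refl-at (one ⊖ const (fromℕℚ 3) ⊛ z)) 2t₂≋) (-‿cong t₃≋))
  where 2t₂≋ = *-cong (≋-refl-at (const (fromℕℚ 2))) t₂≋

zpow-2 : zpow 2 ≋ z ⊛ z
zpow-2 = zpow-suc 1

zpow-3 : zpow 3 ≋ z ⊛ (z ⊛ z)
zpow-3 = ≋-trans (zpow-suc 2) (*-cong (≋-refl-at z) zpow-2)

-- Writing A = 1 − z − z³ and L = 2z(1−z)r, the identity A² − P = 4z²(1−z)² gives
-- (A − L)² − P = 4z(1−z) · kernel r, and A − L = W by hypothesis.
kernelRoot : (W r : FPS) → W ⊛ W ≈ P
  → const (fromℕℚ 2) ⊛ zOneMinusZ ⊛ r ≈ one ⊖ z ⊖ zpow 3 ⊖ W → IsKernelRoot r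
kernelRoot W r W²≈P L≈A′-W = zOneMinusZ⊛-cancel (begin
  zOneMinusZ ⊛ kernel r
    ≈⟨ solve 2 (λ x ρ →
         let A = con 1ℚ :- x :- x :* (x :* x)
             L = con (fromℕℚ 2) :* zOneMinusZᵖ x :* ρ
             x² = x :* x
             x³ = x :* x²
             Pᵖ = (con 1ℚ :+ x :- con (fromℕℚ 2) :* x² :- x³)
               :* (con 1ℚ :- con (fromℕℚ 3) :* x :+ con (fromℕℚ 2) :* x² :- x³)
         in zOneMinusZᵖ x :* kernelᵖ x ρ := con ¼ :* ((A :- L) :* (A :- L) :- Pᵖ)) ≋-refl z r ⟩
  const ¼ ⊛ ((A ⊖ L) ⊛ (A ⊖ L) ⊖ Pz)
    ≈⟨ *-cong (≋-refl-at (const ¼)) (+-cong (*-cong A⊖L≋W A⊖L≋W) (≋-refl-at (⊝ Pz))) ⟩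
  const ¼ ⊛ (W ⊛ W ⊖ Pz)
    ≈⟨ *-cong (≋-refl-at (const ¼)) (+-cong W²≋Pz (≋-refl-at (⊝ Pz))) ⟩
  const ¼ ⊛ (Pz ⊖ Pz)
    ≈⟨ solve 2 (λ c p → c :* (p :- p) := con 0ℚ) ≋-refl (const ¼) Pz ⟩
  0ₛ ∎)
  where
  open SetoidReasoning
  ¼ = ℚ.½ * ℚ.½
  A = one ⊖ z ⊖ z ⊛ (z ⊛ z)
  L = const (fromℕℚ 2) ⊛ zOneMinusZ ⊛ r
  Pz = P[ z ⊛ z , z ⊛ (z ⊛ z) ]
  W²≋Pz : W ⊛ W ≋ Pz
  W²≋Pz = ≋-trans (coeffwise W²≈P) (P[]-cong zpow-2 zpow-3)
  A⊖L≋W : A ⊖ L ≋ W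
  A⊖L≋W = begin
    A ⊖ L          ≈⟨ +-cong (+-cong (≋-refl-at (one ⊖ z)) (-‿cong (≋-sym zpow-3))) (-‿cong (coeffwise L≈A′-W)) ⟩
    A′ ⊖ (A′ ⊖ W)  ≈⟨ solve 2 (λ a w → a :- (a :- w) := w) ≋-refl A′ W ⟩
    W              ∎
    where A′ = one ⊖ z ⊖ zpow 3

-- Generating functions by level

-- Θ r (q , j) is z(1−z) times the series of words ending in q at height j, assuming the total
-- over q is r^(j+1): the U-equation then gives Θ (U , j+1) = z r^(j+1), the H-equation gives
-- Θ (H , j), and Θ (D , j) is the remainder; only the D-equation needs the kernel.
Θᵁ Θᴴ : FPS → ℕ → FPS
Θᵁ r zero    = 0ₛ
Θᵁ r (suc j) = z ⊛ r ^^ suc j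
Θᴴ r zero    = zOneMinusZ ⊕ z ⊛ r ^^ 1
Θᴴ r (suc j) = z ⊛ (r ^^ suc (suc j) ⊖ z ⊛ r ^^ suc j)

Θ : FPS → State → FPS
Θ r (U , j) = Θᵁ r j
Θ r (H , j) = Θᴴ r j
Θ r (D , j) = r ^^ suc j ⊖ Θᵁ r j ⊖ Θᴴ r j

module _ (r : FPS) (root : IsKernelRoot r) where

  private
    modulo-kernel : ∀ {X Y} f → X ≋ Y ⊖ f ⊛ kernel r → X ≋ Y
    modulo-kernel {X} {Y} f X≋ = begin
      X                   ≈⟨ X≋ ⟩
      Y ⊖ f ⊛ kernel r    ≈⟨ +-cong (≋-refl-at Y) (-‿cong (*-cong (≋-refl-at f) root)) ⟩
      Y ⊖ f ⊛ 0ₛ          ≈⟨ solve 2 (λ y f → y :- f :* con 0ℚ := y) ≋-refl Y f ⟩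
      Y                   ∎
      where open SetoidReasoning

  Θ-solution : IsSolution zOneMinusZ (Θ r)
  Θ-solution (U , zero) =
    solve 1 (λ x → con 0ℚ := zOneMinusZᵖ x :* con 0ℚ :+ x :* con 0ℚ) ≋-refl z
  Θ-solution (U , suc j) =
    solve 4 (λ x s u h → x :* s := zOneMinusZᵖ x :* con 0ℚ :+ x :* (u :+ (h :+ (s :- u :- h :+ con 0ℚ))))
      ≋-refl z (r ^^ suc j) (Θᵁ r j) (Θᴴ r j)
  Θ-solution (H , zero) =
    solve 2 (λ x s → let h = zOneMinusZᵖ x :+ x :* s in
                     h := zOneMinusZᵖ x :* con 1ℚ :+ x :* (h :+ (s :- con 0ℚ :- h :+ con 0ℚ)))
      ≋-refl z (r ^^ 1)
  Θ-solution (H , suc j) =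
    solve 3 (λ x s′ s → let h = x :* (s′ :- x :* s) in
                        h := zOneMinusZᵖ x :* con 0ℚ :+ x :* (h :+ (s′ :- x :* s :- h :+ con 0ℚ)))
      ≋-refl z (r ^^ suc (suc j)) (r ^^ suc j)
  Θ-solution (D , zero) = modulo-kernel one (solve 2 (λ x ρ →
      let S₀ = ρ :* con 1ℚ
          S₁ = ρ :* S₀
      in S₀ :- con 0ℚ :- (zOneMinusZᵖ x :+ x :* S₀)
         := zOneMinusZᵖ x :* con 0ℚ :+ x :* (x :* S₀ :+ (S₁ :- x :* S₀ :- x :* (S₁ :- x :* S₀) :+ con 0ℚ))
            :- con 1ℚ :* kernelᵖ x ρ)
    ≋-refl z r)
  Θ-solution (D , suc j) = modulo-kernel (r ^^ suc j) (solve 3 (λ x ρ p →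
      let S₀ = ρ :* p
          S₁ = ρ :* S₀
          S₂ = ρ :* S₁
      in S₁ :- x :* S₀ :- x :* (S₁ :- x :* S₀)
         := zOneMinusZᵖ x :* con 0ℚ :+ x :* (x :* S₁ :+ (S₂ :- x :* S₁ :- x :* (S₂ :- x :* S₁) :+ con 0ℚ))
            :- S₀ :* kernelᵖ x ρ)
    ≋-refl z r (r ^^ j))

  levelGF : ∀ j → zOneMinusZ ⊛ S j ≋ r ^^ suc j
  levelGF j = begin
    zOneMinusZ ⊛ S j
      ≈⟨ *-cong (≋-refl-at zOneMinusZ) (S≋Σ-countSeries j) ⟩
    zOneMinusZ ⊛ Σₛ (map (λ q → countSeries (q , j)) letters)
      ≈⟨ ⊛-Σₛ zOneMinusZ (λ q → countSeries (q , j)) letters ⟩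
    Σₛ (map (λ q → zOneMinusZ ⊛ countSeries (q , j)) letters)
      ≈⟨ Σₛ-map-cong (λ q → solution-unique {zOneMinusZ} scaled-counts-solution Θ-solution (q , j)) letters ⟩
    Σₛ (map (λ q → Θ r (q , j)) letters)
      ≈⟨ solve 3 (λ s u h → u :+ (h :+ (s :- u :- h :+ con 0ℚ)) := s) ≋-refl (r ^^ suc j) (Θᵁ r j) (Θᴴ r j) ⟩
    r ^^ suc j ∎
    where
    open SetoidReasoning
    scaled-counts-solution : IsSolution zOneMinusZ (λ t → zOneMinusZ ⊛ countSeries t)
    scaled-counts-solution = solution-scale zOneMinusZ countSeries-solution

⊛ᵤ-constᵤˡ : ∀ f (G : BFPS) j → (constᵤ f ⊛ᵤ G) j ≋ f ⊛ G j
⊛ᵤ-constᵤˡ f G zero    = ≋-refl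
⊛ᵤ-constᵤˡ f G (suc j) = coeffwise λ n → begin
  sumTo (suc j) (λ i → (constᵤ f i ⊛ G (suc j ∸ i)) n)
    ≡⟨ sumTo-suc j (λ i → (constᵤ f i ⊛ G (suc j ∸ i)) n) ⟩
  (f ⊛ G (suc j)) n + sumTo j (λ i → (constᵤ f (suc i) ⊛ G (j ∸ i)) n)
    ≡⟨ cong ((f ⊛ G (suc j)) n +_) (sumTo-zero j (λ i _ → ⊛-vanishˡ (G (j ∸ i)) (λ _ → refl) n)) ⟩
  (f ⊛ G (suc j)) n + 0ℚ
    ≡⟨ ℚₚ.+-identityʳ _ ⟩
  (f ⊛ G (suc j)) n ∎
  where open ≡-Reasoning

⊛ᵤ-linearʳ : ∀ (F G : BFPS) → (∀ k → G (suc (suc k)) ≋ 0ₛ) →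
  ∀ j → (F ⊛ᵤ G) (suc j) ≋ F j ⊛ G 1 ⊕ F (suc j) ⊛ G 0
⊛ᵤ-linearʳ F G G≋0 j = coeffwise λ n →
  cong₂ _+_ (leading j n) (cong (λ k → (F (suc j) ⊛ G k) n) (ℕₚ.n∸n≡0 j))
  where
  leading : ∀ j n → sumTo j (λ i → (F i ⊛ G (suc j ∸ i)) n) ≡ (F j ⊛ G 1) n
  leading zero    n = refl
  leading (suc k) n = begin
    sumTo k (λ i → (F i ⊛ G (suc (suc k) ∸ i)) n) + (F (suc k) ⊛ G (suc k ∸ k)) n
      ≡⟨ cong₂ _+_ (sumTo-zero k (λ i i≤k → vanish i (k ∸ i) (ℕₚ.+-∸-assoc 2 i≤k)))
                   (cong (λ m → (F (suc k) ⊛ G m) n) (ℕₚ.m+n∸n≡m 1 k)) ⟩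
    0ℚ + (F (suc k) ⊛ G 1) n
      ≡⟨ ℚₚ.+-identityˡ _ ⟩
    (F (suc k) ⊛ G 1) n ∎
    where
    open ≡-Reasoning
    vanish : ∀ i m {l} → l ≡ suc (suc m) → (F i ⊛ G l) n ≡ 0ℚ
    vanish i m refl = trans (⊛-cong {F i} (λ _ → refl) (coeff (G≋0 m)) n)
                            (trans (⊛-comm (F i) 0ₛ n) (⊛-vanishˡ (F i) 0ₛ-coeff n))

module _ (r : FPS) (root : IsKernelRoot r) where

  private
    Δ : BFPS
    Δ = constᵤ one ⊕ᵤ uTimes (⊝ r)

    C : BFPS
    C = constᵤ zOneMinusZ ⊛ᵤ Δ

    C₀≋ : C 0 ≋ zOneMinusZ ⊛ one
    C₀≋ = *-cong (≋-refl-at zOneMinusZ) (coeffwise (λ n → ℚₚ.+-identityʳ (one n)))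

    C₁≋ : C 1 ≋ zOneMinusZ ⊛ ⊝ r
    C₁≋ = ≋-trans (⊛ᵤ-constᵤˡ zOneMinusZ Δ 1)
                  (*-cong (≋-refl-at zOneMinusZ) (coeffwise (λ n → ℚₚ.+-identityˡ (- r n))))

    C≋0 : ∀ k → C (suc (suc k)) ≋ 0ₛ
    C≋0 k = begin
      C (suc (suc k))                   ≈⟨ ⊛ᵤ-constᵤˡ zOneMinusZ Δ (suc (suc k)) ⟩
      zOneMinusZ ⊛ Δ (suc (suc k))      ≈⟨ *-cong (≋-refl-at zOneMinusZ) (coeffwise λ n →
                                             trans (ℚₚ.+-identityˡ 0ℚ) (sym (0ₛ-coeff n))) ⟩
      zOneMinusZ ⊛ 0ₛ                   ≈⟨ solve 1 (λ c → c :* con 0ℚ := con 0ℚ) ≋-refl zOneMinusZ ⟩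
      0ₛ                                ∎
      where open SetoidReasoning

  bivariateGF : S ⊛ᵤ (constᵤ zOneMinusZ ⊛ᵤ (constᵤ one ⊕ᵤ uTimes (⊝ r))) ≈ᵤ constᵤ r
  bivariateGF zero    n = coeff (begin
    S 0 ⊛ C 0                  ≈⟨ *-cong (≋-refl-at (S 0)) C₀≋ ⟩
    S 0 ⊛ (zOneMinusZ ⊛ one)   ≈⟨ solve 2 (λ s c → s :* (c :* con 1ℚ) := c :* s) ≋-refl (S 0) zOneMinusZ ⟩
    zOneMinusZ ⊛ S 0           ≈⟨ levelGF r root 0 ⟩
    r ⊛ one                    ≈⟨ solve 1 (λ ρ → ρ :* con 1ℚ := ρ) ≋-refl r ⟩
    r                          ∎) n
    where open SetoidReasoning
  bivariateGF (suc k) n = trans (coeff (begin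
    (S ⊛ᵤ C) (suc k)
      ≈⟨ ⊛ᵤ-linearʳ S C C≋0 k ⟩
    S k ⊛ C 1 ⊕ S (suc k) ⊛ C 0
      ≈⟨ +-cong (*-cong (≋-refl-at (S k)) C₁≋) (*-cong (≋-refl-at (S (suc k))) C₀≋) ⟩
    S k ⊛ (zOneMinusZ ⊛ ⊝ r) ⊕ S (suc k) ⊛ (zOneMinusZ ⊛ one)
      ≈⟨ solve 4 (λ s s′ c ρ → s :* (c :* :- ρ) :+ s′ :* (c :* con 1ℚ) := :- (ρ :* (c :* s)) :+ c :* s′)
           ≋-refl (S k) (S (suc k)) zOneMinusZ r ⟩
    ⊝ (r ⊛ (zOneMinusZ ⊛ S k)) ⊕ zOneMinusZ ⊛ S (suc k)
      ≈⟨ +-cong (-‿cong (*-cong (≋-refl-at r) (levelGF r root k))) (levelGF r root (suc k)) ⟩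
    ⊝ (r ^^ suc (suc k)) ⊕ r ^^ suc (suc k)
      ≈⟨ solve 1 (λ a → :- a :+ a := con 0ℚ) ≋-refl (r ^^ suc (suc k)) ⟩
    0ₛ ∎) n) (0ₛ-coeff n)
    where open SetoidReasoning

mainTheorem8 : (W r₁ : FPS)
    → W ⊛ W ≈ P → W 0 ≡ 1ℚ
    → const (fromℕℚ 2) ⊛ zOneMinusZ ⊛ r₁ ≈ one ⊖ z ⊖ zpow 3 ⊖ W
    → (S ⊛ᵤ (constᵤ zOneMinusZ ⊛ᵤ (constᵤ one ⊕ᵤ uTimes (⊝ r₁))) ≈ᵤ constᵤ r₁)
      × (∀ (j : ℕ) → zOneMinusZ ⊛ S j ≈ r₁ ^^ suc j)
mainTheorem8 W r₁ W²≈P _ L≈A′-W = bivariateGF r₁ root , λ j → coeff (levelGF r₁ root j)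
  where
  root : IsKernelRoot r₁
  root = kernelRoot W r₁ W²≈P L≈A′-W
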